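{- Let $\mathfrak M_0=\langle S_0,L_0,\mathrm I_0\rangle$ be a finite partial linear space in which every point lies on exactly $\kappa$ lines and every line has exactly $\rho$ points, with $\rho\neq\kappa$. Let $G$ be $\mathbb Z$ or $C_k$ with $k$ even, $k>2$. Then for every point $p$ and every line $l$ of $\mathfrak M_0\circledast_\circ G$: $p\wr l$ iff $p\,\mathrm I\,l$ and $\mathrm r(p)=\mathrm r(l)$.
   Context: PLS: incidence structure $\langle S,\mathcal L,\mathrm I\rangle$, $S\cap\mathcal L=\emptyset$, every line on at least two points, every point on at least two lines, two distinct points on at most one common line. Dual multiplying $\mathfrak M_0\circledast_\circ G$: point set $\bigcup_{i\in G}M_i$, line set $\bigcup_i\mathcal L_i$, where $M_i=\{i\}\times S_0$, $\mathcal L_i=\{i\}\times L_0$ for even $i$ and $M_i=\{i\}\times L_0$, $\mathcal L_i=\{i\}\times S_0$ for odd $i$; points $(i,a)$, lines $[j,b]$, $(i,a)\,\mathrm I\,[j,b]$ iff either $i=j$ and ($a\,\mathrm I_0\,b$ or $b\,\mathrm I_0\,a$), or $i=j+1$ and $a=b$. $(i,p')\wr[j,l']$ iff $(i,p')\,\mathrm I\,[j,l']$ and $i=j+1$. $\mathrm r(x)$ denotes the number of lines through $x$ if $x$ is a point, and the number of points on $x$ if $x$ is a line. -}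

module Defs where

open import Data.Bool using (Bool; true; false; T; not)
open import Data.Nat using (ℕ; zero; suc; _≤_; _%_; _≡ᵇ_)
open import Data.Nat.DivMod using (_mod_)
open import Data.Fin using (Fin; toℕ)
open import Data.Integer as ℤ using (ℤ; ∣_∣)
open import Data.Sum using (_⊎_; inj₁; inj₂)
open import Data.Product using (Σ; Σ-syntax; ∃; _×_)
open import Data.Empty using (⊥)
open import Relation.Binary.PropositionalEquality using (_≡_; _≢_)
open import Function.Bundles using (_↔_)

count : ∀ {n} → (Fin n → Bool) → ℕ
count {zero}  f = 0
count {suc n} f with f Fin.zero
... | true  = suc (count (λ i → f (Fin.suc i)))
... | false = count (λ i → f (Fin.suc i))

record PLS : Set where
  field
    nP nL : ℕ
    I₀    : Fin nP → Fin nL → Bool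
    line≥2  : ∀ l → 2 ≤ count (λ p → I₀ p l)
    point≥2 : ∀ p → 2 ≤ count (λ l → I₀ p l)
    unique  : ∀ p q l m → p ≢ q →
              T (I₀ p l) → T (I₀ q l) → T (I₀ p m) → T (I₀ q m) → l ≡ m

record Tactical (M : PLS) (κ ρ : ℕ) : Set where
  open PLS M
  field
    pointRank : ∀ p → count (λ l → I₀ p l) ≡ κ
    lineRank  : ∀ l → count (λ p → I₀ p l) ≡ ρ

-- Index "group" G: only the successor i ↦ i + 1 and the parity of i
-- are used by the construction.

record IndexGroup : Set₁ where
  field
    Carrier : Set
    next    : Carrier → Carrier
    isEven  : Carrier → Bool

open IndexGroup public

evenℕ : ℕ → Bool
evenℕ n = n % 2 ≡ᵇ 0

ℤG : IndexGroup
ℤG = record { Carrier = ℤ ; next = λ i → i ℤ.+ ℤ.1ℤ ; isEven = λ i → evenℕ ∣ i ∣ }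

sucMod : ∀ {k} → Fin k → Fin k
sucMod {suc n} i = suc (toℕ i) mod suc n

-- cyclic group C_k = ℤ/kℤ represented by Fin k (parity well defined for even k)
CG : ℕ → IndexGroup
CG k = record { Carrier = Fin k ; next = sucMod ; isEven = λ i → evenℕ (toℕ i) }

module DualMultiplying (M : PLS) (G : IndexGroup) where
  open PLS M

  El : Set
  El = Fin nP ⊎ Fin nL

  PointKind : Carrier G → El → Set
  PointKind i (inj₁ _) = T (isEven G i)
  PointKind i (inj₂ _) = T (not (isEven G i))

  LineKind : Carrier G → El → Set
  LineKind i (inj₁ _) = T (not (isEven G i))
  LineKind i (inj₂ _) = T (isEven G i)

  Point : Set
  Point = Σ[ i ∈ Carrier G ] Σ[ a ∈ El ] PointKind i a

  Line : Set
  Line = Σ[ j ∈ Carrier G ] Σ[ b ∈ El ] LineKind j b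

  I₀sym : El → El → Set
  I₀sym (inj₁ p) (inj₂ l) = T (I₀ p l)
  I₀sym (inj₂ l) (inj₁ p) = T (I₀ p l)
  I₀sym _        _        = ⊥

  _I_ : Point → Line → Set
  (i Data.Product., a Data.Product., _) I (j Data.Product., b Data.Product., _) =
    (i ≡ j × I₀sym a b) ⊎ (i ≡ next G j × a ≡ b)

  _≀_ : Point → Line → Set
  p ≀ l = p I l × Data.Product.proj₁ p ≡ next G (Data.Product.proj₁ l)

  SameRank : Point → Line → Set
  SameRank p l = ∃ λ (n : ℕ) →
    ((Σ[ m ∈ Line ] p I m) ↔ Fin n) × ((Σ[ q ∈ Point ] q I l) ↔ Fin n)

  Claim : Set
  Claim = ∀ (p : Point) (l : Line) →
    (p ≀ l → (p I l × SameRank p l)) × ((p I l × SameRank p l) → p ≀ l)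

-- In M₀ ⊛∘ G a point (i, a) lies on the lines [i, b] with a, b incident in
-- M₀ and on the single line [i − 1, a]; dually a line [j, b] carries the
-- points (j, a) with a, b incident and the point (j + 1, b). Hence both ranks
-- are one more than the rank of the underlying element of M₀. Since i + 1
-- and i have different parity, an incident pair is either of the form
-- (j + 1, b), [j, b], where both ranks are r₀(b) + 1, or of the form (i, a),
-- [i, b] with a, b incident in M₀, where one of a, b is a point and the other
-- a line, so the ranks are κ + 1 and ρ + 1, which differ.
module Submission where

open import Defs
open import Data.Nat using (ℕ; _<_; _%_)
open import Data.Product using (_×_)
open import Relation.Binary.PropositionalEquality using (_≡_; _≢_)

open import Data.Bool using (Bool; true; false; T; not; if_then_else_)
open import Data.Bool.Properties using (T-irrelevant; not-involutive; not-¬)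
open import Data.Empty using (⊥; ⊥-elim)
open import Data.Fin using (Fin; zero; suc; toℕ; fromℕ; inject₁)
open import Data.Fin.Permutation using (↔⇒≡)
open import Data.Fin.Properties
  using (0↔⊥; 1↔⊤; +↔⊎; toℕ-injective; toℕ-fromℕ<; toℕ-fromℕ; toℕ-inject₁; toℕ<n)
open import Data.Fin.Relation.Unary.Top using (view; ‵fromℕ; ‵inj₁)
open import Data.Integer as ℤ using (+_; -[1+_]; 1ℤ; -1ℤ)
import Data.Integer.Properties as ℤ
open import Data.Nat using (zero; suc; _+_; _≡ᵇ_; s<s)
open import Data.Nat.DivMod using (m%n<n; n%n≡0; m<n⇒m%n≡m)
open import Data.Nat.Properties using (suc-injective; +-comm)
open import Data.Product using (Σ; Σ-syntax; _,_)
import Data.Product.Function.Dependent.Propositional as Σ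
open import Data.Sum using (_⊎_; inj₁; inj₂; [_,_]; [_,_]′)
open import Data.Sum.Function.Propositional using (_⊎-cong_)
open import Data.Unit using (⊤; tt)
open import Function using (_∘_; id)
open import Function.Bundles using (_↔_; mk↔ₛ′; _⇔_; mk⇔; Equivalence)
open import Function.Properties.Inverse using (↔-refl; ↔-sym; ↔-trans)
open import Function.Related.TypeIsomorphisms using (⊎-comm)
open import Relation.Binary.PropositionalEquality
  using (refl; sym; trans; cong; subst; ≢-sym)

Σ-Fin-suc↔ : ∀ {n} {P : Fin (suc n) → Set} →
             Σ (Fin (suc n)) P ↔ (P zero ⊎ Σ (Fin n) (P ∘ suc))
Σ-Fin-suc↔ = mk↔ₛ′
  (λ { (zero , x) → inj₁ x ; (suc i , x) → inj₂ (i , x) })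
  [ (λ x → zero , x) , (λ (i , x) → suc i , x) ]′
  [ (λ _ → refl) , (λ _ → refl) ]
  (λ { (zero , _) → refl ; (suc _ , _) → refl })

Σ-⊎-inj₁↔ : ∀ {A B : Set} {P : A ⊎ B → Set} → (∀ b → P (inj₂ b) → ⊥) →
            Σ (A ⊎ B) P ↔ Σ A (P ∘ inj₁)
Σ-⊎-inj₁↔ ¬P₂ = mk↔ₛ′
  (λ { (inj₁ a , x) → a , x ; (inj₂ b , x) → ⊥-elim (¬P₂ b x) })
  (λ (a , x) → inj₁ a , x)
  (λ _ → refl)
  (λ { (inj₁ _ , _) → refl ; (inj₂ b , x) → ⊥-elim (¬P₂ b x) })

Σ-⊎-inj₂↔ : ∀ {A B : Set} {P : A ⊎ B → Set} → (∀ a → P (inj₁ a) → ⊥) →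
            Σ (A ⊎ B) P ↔ Σ B (P ∘ inj₂)
Σ-⊎-inj₂↔ ¬P₁ = mk↔ₛ′
  (λ { (inj₁ a , x) → ⊥-elim (¬P₁ a x) ; (inj₂ b , x) → b , x })
  (λ (b , x) → inj₂ b , x)
  (λ _ → refl)
  (λ { (inj₁ a , x) → ⊥-elim (¬P₁ a x) ; (inj₂ _ , _) → refl })

⊎⊤↔Fin-suc : ∀ {A : Set} {n} → A ↔ Fin n → (A ⊎ ⊤) ↔ Fin (suc n)
⊎⊤↔Fin-suc A↔n = ↔-trans (A↔n ⊎-cong ↔-sym 1↔⊤) (↔-trans (⊎-comm _ _) (↔-sym +↔⊎))

bit : Bool → ℕ
bit b = if b then 1 else 0

T↔Fin-bit : ∀ b → T b ↔ Fin (bit b)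
T↔Fin-bit true  = ↔-sym 1↔⊤
T↔Fin-bit false = ↔-sym 0↔⊥

count-suc : ∀ {n} (f : Fin (suc n) → Bool) → count f ≡ bit (f zero) + count (f ∘ suc)
count-suc f with f zero
... | true  = refl
... | false = refl

Σ-T↔Fin-count : ∀ {n} (f : Fin n → Bool) → Σ (Fin n) (T ∘ f) ↔ Fin (count f)
Σ-T↔Fin-count {zero}  f = mk↔ₛ′ (λ { (() , _) }) (λ ()) (λ ()) (λ { (() , _) })
Σ-T↔Fin-count {suc n} f =
  subst (λ m → Σ (Fin (suc n)) (T ∘ f) ↔ Fin m) (sym (count-suc f))
    (↔-trans Σ-Fin-suc↔
      (↔-trans (T↔Fin-bit (f zero) ⊎-cong Σ-T↔Fin-count (f ∘ suc)) (↔-sym +↔⊎)))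

evenℕ-suc : ∀ n → evenℕ (suc n) ≡ not (evenℕ n)
evenℕ-suc zero          = refl
evenℕ-suc (suc zero)    = refl
evenℕ-suc (suc (suc n)) = evenℕ-suc n

record IsAlternating (G : IndexGroup) : Set where
  field
    prev        : Carrier G → Carrier G
    next∘prev   : ∀ i → next G (prev i) ≡ i
    prev∘next   : ∀ i → prev (next G i) ≡ i
    isEven-next : ∀ i → isEven G (next G i) ≡ not (isEven G i)

  next≢ : ∀ i → next G i ≢ i
  next≢ i e = not-¬ refl (trans (cong (isEven G) (sym e)) (isEven-next i))

module DualRanks (M : PLS) {G : IndexGroup} (alt : IsAlternating G) where
  open PLS M
  open DualMultiplying M G
  open IsAlternating alt

  rank₀ : El → ℕ
  rank₀ (inj₁ p) = count (λ l → I₀ p l)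
  rank₀ (inj₂ l) = count (λ p → I₀ p l)

  I₀sym-comm : ∀ a b → I₀sym a b ≡ I₀sym b a
  I₀sym-comm (inj₁ _) (inj₁ _) = refl
  I₀sym-comm (inj₁ _) (inj₂ _) = refl
  I₀sym-comm (inj₂ _) (inj₁ _) = refl
  I₀sym-comm (inj₂ _) (inj₂ _) = refl

  adjacent↔ : ∀ a → Σ El (I₀sym a) ↔ Fin (rank₀ a)
  adjacent↔ (inj₁ p) = ↔-trans (Σ-⊎-inj₂↔ (λ _ ())) (Σ-T↔Fin-count _)
  adjacent↔ (inj₂ l) = ↔-trans (Σ-⊎-inj₁↔ (λ _ ())) (Σ-T↔Fin-count _)

  adjacent′↔ : ∀ b → Σ El (λ a → I₀sym a b) ↔ Fin (rank₀ b)
  adjacent′↔ b =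
    ↔-trans (Σ.congˡ λ {a} → subst (I₀sym a b ↔_) (I₀sym-comm a b) ↔-refl) (adjacent↔ b)

  PointKind-irrelevant : ∀ i a (k k′ : PointKind i a) → k ≡ k′
  PointKind-irrelevant i (inj₁ _) = T-irrelevant
  PointKind-irrelevant i (inj₂ _) = T-irrelevant

  LineKind-irrelevant : ∀ i a (k k′ : LineKind i a) → k ≡ k′
  LineKind-irrelevant i (inj₁ _) = T-irrelevant
  LineKind-irrelevant i (inj₂ _) = T-irrelevant

  LineKind-adjacent : ∀ i a b → PointKind i a → I₀sym a b → LineKind i b
  LineKind-adjacent i (inj₁ _) (inj₂ _) k _ = k
  LineKind-adjacent i (inj₂ _) (inj₁ _) k _ = k

  PointKind-adjacent : ∀ j a b → LineKind j b → I₀sym a b → PointKind j a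
  PointKind-adjacent j (inj₁ _) (inj₂ _) k _ = k
  PointKind-adjacent j (inj₂ _) (inj₁ _) k _ = k

  LineKind≡PointKind-next : ∀ j a → LineKind j a ≡ PointKind (next G j) a
  LineKind≡PointKind-next j (inj₁ _) = cong T (sym (isEven-next j))
  LineKind≡PointKind-next j (inj₂ _) =
    cong T (trans (sym (not-involutive _)) (cong not (sym (isEven-next j))))

  PointKind-next : ∀ j a → LineKind j a → PointKind (next G j) a
  PointKind-next j a = subst id (LineKind≡PointKind-next j a)

  LineKind-prev : ∀ i a → PointKind i a → LineKind (prev i) a
  LineKind-prev i a k =
    subst id (sym (LineKind≡PointKind-next (prev i) a))
      (subst (λ i′ → PointKind i′ a) (sym (next∘prev i)) k)

  lines-through↔ : ∀ i a k → Σ Line ((i , a , k) I_) ↔ (Σ El (I₀sym a) ⊎ ⊤)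
  lines-through↔ i a k = mk↔ₛ′ to from (λ { (inj₁ _) → refl ; (inj₂ _) → refl }) from∘to
    where
    to : Σ Line ((i , a , k) I_) → Σ El (I₀sym a) ⊎ ⊤
    to ((_ , b , _) , inj₁ (_ , s)) = inj₁ (b , s)
    to (_           , inj₂ _)       = inj₂ tt
    from : Σ El (I₀sym a) ⊎ ⊤ → Σ Line ((i , a , k) I_)
    from (inj₁ (b , s)) = (i , b , LineKind-adjacent i a b k s) , inj₁ (refl , s)
    from (inj₂ _)       = (prev i , a , LineKind-prev i a k) , inj₂ (sym (next∘prev i) , refl)
    shifted-line-unique : ∀ j j′ → j′ ≡ j → (k′ : LineKind j′ a) (k″ : LineKind j a)
                          (e′ : i ≡ next G j′) (e″ : i ≡ next G j) →
                          _≡_ {A = Σ Line ((i , a , k) I_)}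
                              ((j′ , a , k′) , inj₂ (e′ , refl))
                              ((j , a , k″) , inj₂ (e″ , refl))
    shifted-line-unique j .j refl k′ k″ refl refl
      rewrite LineKind-irrelevant j a k′ k″ = refl
    from∘to : ∀ x → from (to x) ≡ x
    from∘to ((_ , b , k′) , inj₁ (refl , s))
      rewrite LineKind-irrelevant i b (LineKind-adjacent i a b k s) k′ = refl
    from∘to ((j , _ , k′) , inj₂ (e , refl)) =
      shifted-line-unique j (prev i) (trans (cong prev e) (prev∘next j)) _ k′ _ e

  points-on↔ : ∀ j b k → Σ Point (_I (j , b , k)) ↔ (Σ El (λ a → I₀sym a b) ⊎ ⊤)
  points-on↔ j b k = mk↔ₛ′ to from (λ { (inj₁ _) → refl ; (inj₂ _) → refl }) from∘to
    where
    to : Σ Point (_I (j , b , k)) → Σ El (λ a → I₀sym a b) ⊎ ⊤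
    to ((_ , a , _) , inj₁ (_ , s)) = inj₁ (a , s)
    to (_           , inj₂ _)       = inj₂ tt
    from : Σ El (λ a → I₀sym a b) ⊎ ⊤ → Σ Point (_I (j , b , k))
    from (inj₁ (a , s)) = (j , a , PointKind-adjacent j a b k s) , inj₁ (refl , s)
    from (inj₂ _)       = (next G j , b , PointKind-next j b k) , inj₂ (refl , refl)
    from∘to : ∀ x → from (to x) ≡ x
    from∘to ((_ , a , k′) , inj₁ (refl , s))
      rewrite PointKind-irrelevant j a (PointKind-adjacent j a b k s) k′ = refl
    from∘to ((_ , _ , k′) , inj₂ (refl , refl))
      rewrite PointKind-irrelevant (next G j) b (PointKind-next j b k) k′ = refl

  SameRank⇔ : ∀ i a k j b k′ →
              SameRank (i , a , k) (j , b , k′) ⇔ (rank₀ a ≡ rank₀ b)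
  SameRank⇔ i a k j b k′ = mk⇔
    (λ (_ , lines↔n , points↔n) →
      suc-injective (↔⇒≡ (↔-trans (↔-sym lines↔) (↔-trans lines↔n
                                   (↔-trans (↔-sym points↔n) points↔)))))
    (λ r → suc (rank₀ a) , lines↔ , subst (λ m → _ ↔ Fin (suc m)) (sym r) points↔)
    where
    lines↔  = ↔-trans (lines-through↔ i a k) (⊎⊤↔Fin-suc (adjacent↔ a))
    points↔ = ↔-trans (points-on↔ j b k′) (⊎⊤↔Fin-suc (adjacent′↔ b))

  rank₀-point≢rank₀-line : ∀ {κ ρ} → Tactical M κ ρ → ρ ≢ κ →
                           ∀ p l → rank₀ (inj₁ p) ≢ rank₀ (inj₂ l)
  rank₀-point≢rank₀-line tac ρ≢κ p l e =
    ρ≢κ (trans (sym (lineRank l)) (trans (sym e) (pointRank p)))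
    where open Tactical tac

  rank₀-adjacent≢ : ∀ {κ ρ} → Tactical M κ ρ → ρ ≢ κ → ∀ a b → I₀sym a b → rank₀ a ≢ rank₀ b
  rank₀-adjacent≢ tac ρ≢κ (inj₁ p) (inj₂ l) _ = rank₀-point≢rank₀-line tac ρ≢κ p l
  rank₀-adjacent≢ tac ρ≢κ (inj₂ l) (inj₁ p) _ = ≢-sym (rank₀-point≢rank₀-line tac ρ≢κ p l)

  ≀⇔I×SameRank : ∀ {κ ρ} → Tactical M κ ρ → ρ ≢ κ → Claim
  ≀⇔I×SameRank tac ρ≢κ (i , a , k) (j , b , k′) = wr⇒ , ⇒wr
    where
    open Equivalence (SameRank⇔ i a k j b k′)
    wr⇒ : (i , a , k) ≀ (j , b , k′) →
          (i , a , k) I (j , b , k′) × SameRank (i , a , k) (j , b , k′)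
    wr⇒ (inj₁ (refl , _) , e) = ⊥-elim (next≢ i (sym e))
    wr⇒ (inj₂ (e , refl) , _) = inj₂ (e , refl) , from refl
    ⇒wr : (i , a , k) I (j , b , k′) × SameRank (i , a , k) (j , b , k′) →
          (i , a , k) ≀ (j , b , k′)
    ⇒wr (inj₁ (refl , s) , same) = ⊥-elim (rank₀-adjacent≢ tac ρ≢κ a b s (to same))
    ⇒wr (inj₂ (e , r)    , _)    = inj₂ (e , r) , e

ℤ-alternating : IsAlternating ℤG
ℤ-alternating = record
  { prev        = ℤ._+ -1ℤ
  ; next∘prev   = λ i → trans (ℤ.+-assoc i -1ℤ 1ℤ) (ℤ.+-identityʳ i)
  ; prev∘next   = λ i → trans (ℤ.+-assoc i 1ℤ -1ℤ) (ℤ.+-identityʳ i)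
  ; isEven-next = parity
  }
  where
  parity : ∀ i → evenℕ ℤ.∣ i ℤ.+ 1ℤ ∣ ≡ not (evenℕ ℤ.∣ i ∣)
  parity (+ n) rewrite +-comm n 1 = evenℕ-suc n
  parity -[1+ zero ]  = refl
  parity -[1+ suc n ] = evenℕ-suc n

-- C_k with k = n + 1; the wrap-around n ↦ 0 flips parity only because k is even.
module Cyclic (n : ℕ) where

  toℕ-sucMod : ∀ i → toℕ (sucMod {suc n} i) ≡ suc (toℕ i) % suc n
  toℕ-sucMod i = toℕ-fromℕ< (m%n<n (suc (toℕ i)) (suc n))

  sucMod-fromℕ : sucMod (fromℕ n) ≡ zero
  sucMod-fromℕ = toℕ-injective
    (trans (toℕ-sucMod (fromℕ n))
      (trans (cong (λ m → suc m % suc n) (toℕ-fromℕ n)) (n%n≡0 (suc n))))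

  sucMod-inject₁ : ∀ (i : Fin n) → sucMod (inject₁ i) ≡ suc i
  sucMod-inject₁ i = toℕ-injective
    (trans (toℕ-sucMod (inject₁ i))
      (trans (cong (λ m → suc m % suc n) (toℕ-inject₁ i)) (m<n⇒m%n≡m (s<s (toℕ<n i)))))

  predMod : Fin (suc n) → Fin (suc n)
  predMod zero    = fromℕ n
  predMod (suc i) = inject₁ i

  sucMod-predMod : ∀ i → sucMod (predMod i) ≡ i
  sucMod-predMod zero    = sucMod-fromℕ
  sucMod-predMod (suc i) = sucMod-inject₁ i

  predMod-sucMod : ∀ i → predMod (sucMod i) ≡ i
  predMod-sucMod i with view i
  ... | ‵fromℕ          rewrite sucMod-fromℕ    = refl
  ... | ‵inj₁ {i = j} _ rewrite sucMod-inject₁ j = refl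

  alternating : suc n % 2 ≡ 0 → IsAlternating (CG (suc n))
  alternating even = record
    { prev        = predMod
    ; next∘prev   = sucMod-predMod
    ; prev∘next   = predMod-sucMod
    ; isEven-next = parity
    }
    where
    n-odd : not (evenℕ n) ≡ true
    n-odd = trans (sym (evenℕ-suc n)) (cong (_≡ᵇ 0) even)
    parity : ∀ i → evenℕ (toℕ (sucMod i)) ≡ not (evenℕ (toℕ i))
    parity i with view i
    ... | ‵fromℕ rewrite sucMod-fromℕ | toℕ-fromℕ n = sym n-odd
    ... | ‵inj₁ {i = j} _ rewrite sucMod-inject₁ j | toℕ-inject₁ j = evenℕ-suc (toℕ j)

corollary2p7 : (M : PLS) (κ ρ : ℕ) → Tactical M κ ρ → ρ ≢ κ →
    DualMultiplying.Claim M ℤG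
      × (∀ (k : ℕ) → k % 2 ≡ 0 → 2 < k → DualMultiplying.Claim M (CG k))
corollary2p7 M κ ρ tac ρ≢κ =
  DualRanks.≀⇔I×SameRank M ℤ-alternating tac ρ≢κ ,
  λ { zero    _    ()
    ; (suc n) even _  → DualRanks.≀⇔I×SameRank M (Cyclic.alternating n even) tac ρ≢κ }
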